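{- Let $n\in\mathbb{N}$ and let $K_{n,n}$ be the complete bipartite graph with bipartition $(U,V)$, $|U|=|V|=n$. Then for every continuous sequence $L$ of length $n$, $K_{n,n}$ has an interval coloring $\alpha$ such that $LSE(U,\alpha)=LSE(V,\alpha)=L$.
   Context: All graphs are finite, undirected, without loops or multiple edges. A proper edge-coloring of $G$ with consecutive integers $c_1,\ldots,c_t$ is an interval $t$-coloring if all $t$ colors are used and for every vertex $v$ the spectrum $S(v,\alpha)$ (set of colors on edges incident to $v$) is an interval of integers; an interval coloring is an interval $t$-coloring for some $t$. $\underline S(v,\alpha)$ and $\overline S(v,\alpha)$ denote the minimum and maximum of $S(v,\alpha)$. For $V'=\{v_1,\ldots,v_k\}\subseteq V(G)$, $LSE(V',\alpha)$ is the sequence of the numbers $\underline S(v_i,\alpha)$, $i=1,\ldots,k$ (with multiplicity), arranged in nondecreasing order; $USE(V',\alpha)$ is analogously the nondecreasing arrangement of the numbers $\overline S(v_i,\alpha)$. An ordered (nondecreasing) sequence $L$ of nonnegative integers is continuous if it contains every integer between its smallest and largest element. -}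

module Defs where

open import Data.Nat using (ℕ; zero; suc; _≤_; _⊓_)
open import Data.Nat.Properties using (≤-decTotalOrder; ≤-totalOrder)
open import Data.Fin using (Fin)
open import Data.List using (List; []; _∷_; map; length; allFin)
open import Data.List.Membership.Propositional using (_∈_)
open import Data.List.Relation.Unary.Sorted.TotalOrder ≤-totalOrder using (Sorted)
open import Data.Product using (∃; _×_)
open import Relation.Binary.PropositionalEquality using (_≡_; _≢_)
open import Data.List.Sort ≤-decTotalOrder using (sort)

IsIntervalList : List ℕ → Set
IsIntervalList xs = ∀ a b c → a ∈ xs → b ∈ xs → a ≤ c → c ≤ b → c ∈ xs

-- An edge colouring of K_{n,n}: U = Fin n, V = Fin n, α u v is the colour of uv.
EdgeColouring : ℕ → Set
EdgeColouring n = Fin n → Fin n → ℕ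

specU : ∀ {n} → EdgeColouring n → Fin n → List ℕ
specU {n} α u = map (λ v → α u v) (allFin n)

specV : ∀ {n} → EdgeColouring n → Fin n → List ℕ
specV {n} α v = map (λ u → α u v) (allFin n)

allColours : ∀ {n} → EdgeColouring n → List ℕ
allColours {n} α = Data.List.concatMap (specU α) (allFin n)
  where import Data.List

Proper : ∀ {n} → EdgeColouring n → Set
Proper {n} α =
  (∀ u v v' → v ≢ v' → α u v ≢ α u v') ×
  (∀ v u u' → u ≢ u' → α u v ≢ α u' v)

-- Interval colouring: proper, the set of used colours is a set of
-- consecutive integers (an interval t-colouring for t = number of colours),
-- and every spectrum is an interval.
IsIntervalColouring : ∀ {n} → EdgeColouring n → Set
IsIntervalColouring {n} α =
  Proper α ×
  IsIntervalList (allColours α) ×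
  (∀ u → IsIntervalList (specU α u)) ×
  (∀ v → IsIntervalList (specV α v))

-- minimum of a list (value on [] irrelevant: only used for nonempty spectra)
minL : List ℕ → ℕ
minL [] = 0
minL (x ∷ []) = x
minL (x ∷ y ∷ xs) = x ⊓ minL (y ∷ xs)

LSE-U : ∀ {n} → EdgeColouring n → List ℕ
LSE-U {n} α = sort (map (λ u → minL (specU α u)) (allFin n))

LSE-V : ∀ {n} → EdgeColouring n → List ℕ
LSE-V {n} α = sort (map (λ v → minL (specV α v)) (allFin n))

Continuous : List ℕ → Set
Continuous L = Sorted L × IsIntervalList L

module Submission where

-- Let L = d₀ ≤ d₁ ≤ … ≤ d_{n-1} be continuous, so consecutive entries differ by 0 or 1.
-- Colour the edge u_i v_j of K_{n,n} by
--     d_j + i                   if column j is fresh (j = 0 or d_j = d_{j-1} + 1),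
--     d_j + ((i − j) mod n)     if column j repeats  (d_j = d_{j-1}).
-- Column j then receives the colours d_j + (a permutation of 0,…,n-1).  In row i the colours
-- fall into three bands — repeated columns j ≤ i, fresh columns, repeated columns j > i — which
-- are ordered and strictly monotone inside each band, and all lie in [d_i, d_i + n).
-- So every vertex w sees n distinct colours in a window [d_w, d_w + n): its spectrum is that
-- window and its lower end is d_w, whence LSE(U) = LSE(V) = L.

open import Defs
open import Data.Nat
open import Data.Nat.Properties
open import Data.Nat.Tactic.RingSolver using (solve-∀)
open import Data.Fin as Fin using (Fin; toℕ; fromℕ<; punchOut)
open import Data.Fin.Properties
  using (toℕ<n; toℕ-injective; fromℕ<-injective; punchOut-injective; injective⇒≤; any?)
  renaming (_≟_ to _≟ᶠ_)
open import Data.List using (List; []; _∷_; length; map; allFin; lookup)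
open import Data.List.Properties using (map-cong; map-tabulate; tabulate-lookup)
open import Data.List.Membership.Propositional using (_∈_; find; lose)
open import Data.List.Membership.Propositional.Properties
  using (∈-map⁺; ∈-map⁻; ∈-allFin; ∈-concatMap⁺; ∈-concatMap⁻)
open import Data.List.Relation.Unary.Any using (here; there; index)
open import Data.List.Relation.Unary.Any.Properties using (lookup-index)
open import Data.List.Relation.Unary.Linked using ([-]; _∷_)
open import Data.List.Relation.Unary.Sorted.TotalOrder ≤-totalOrder using (Sorted)
open import Data.List.Relation.Unary.Sorted.TotalOrder.Properties using (↗↭↗⇒≋)
open import Data.List.Relation.Binary.Permutation.Propositional using (↭⇒↭ₛ)
open import Data.List.Relation.Binary.Pointwise using (Pointwise-≡⇒≡)
open import Data.List.Sort ≤-decTotalOrder using (sort; sort-↭; sort-↗)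
open import Data.Product using (Σ; ∃; _×_; _,_; proj₁; proj₂)
open import Data.Empty using (⊥; ⊥-elim)
open import Data.Sum using (inj₁; inj₂)
open import Relation.Nullary using (¬_; Dec; yes; no)
open import Relation.Binary.Definitions using (tri<; tri≈; tri>)
open import Relation.Binary.PropositionalEquality

-- Pigeonhole: an injective endomap of a finite set is onto.  If y were missed, punching y
-- out of the codomain would inject Fin (suc m) into Fin m.
fin-injective⇒surjective : ∀ {n} (f : Fin n → Fin n) → (∀ x y → f x ≡ f y → x ≡ y) →
  ∀ y → ∃ λ x → f x ≡ y
fin-injective⇒surjective {zero} f injective ()
fin-injective⇒surjective {suc m} f injective y with any? (λ x → f x ≟ᶠ y)
... | yes hit = hit
... | no miss = ⊥-elim (<-irrefl refl (injective⇒≤ {f = squeeze} squeeze-injective))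
  where
  missed : ∀ x → y ≢ f x
  missed x eq = miss (x , sym eq)
  squeeze : Fin (suc m) → Fin m
  squeeze x = punchOut (missed x)
  squeeze-injective : ∀ {x z} → squeeze x ≡ squeeze z → x ≡ z
  squeeze-injective {x} {z} eq = injective x z (punchOut-injective (missed x) (missed z) eq)

minL-≤ : ∀ {x} xs → x ∈ xs → minL xs ≤ x
minL-≤ (y ∷ []) (here refl) = ≤-refl
minL-≤ (y ∷ z ∷ xs) (here refl) = m⊓n≤m y _
minL-≤ (y ∷ z ∷ xs) (there p) = ≤-trans (m⊓n≤n y _) (minL-≤ (z ∷ xs) p)

minL-∈ : ∀ y xs → minL (y ∷ xs) ∈ (y ∷ xs)
minL-∈ y [] = here refl
minL-∈ y (z ∷ xs) with ⊓-sel y (minL (z ∷ xs))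
... | inj₁ e rewrite e = here refl
... | inj₂ e rewrite e = there (minL-∈ z xs)

minL-greatest : ∀ {b z} xs → z ∈ xs → (∀ {x} → x ∈ xs → b ≤ x) → b ≤ minL xs
minL-greatest (y ∷ ys) _ bound = bound (minL-∈ y ys)

-- An injective map f : Fin n → ℕ with values in the window [b, b + n) hits every point of
-- the window, so its list of values is an interval, with minimum b when n > 0.
module Window (n : ℕ) (f : Fin n → ℕ) (b : ℕ)
    (above : ∀ x → b ≤ f x) (below : ∀ x → f x < b + n)
    (injective : ∀ x y → f x ≡ f y → x ≡ y) where

  values : List ℕ
  values = map f (allFin n)

  member : ∀ x → f x ∈ values
  member x = ∈-map⁺ f (∈-allFin x)

  from-member : ∀ {c} → c ∈ values → ∃ λ x → f x ≡ c
  from-member p with ∈-map⁻ f p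
  ... | x , _ , e = x , sym e

  offset< : ∀ {c} → b ≤ c → c < b + n → c ∸ b < n
  offset< {c} b≤c c<b+n = subst (c ∸ b <_) (m+n∸m≡n b n) (∸-monoˡ-< c<b+n b≤c)

  same-offset : ∀ {c c'} → b ≤ c → b ≤ c' → c ∸ b ≡ c' ∸ b → c ≡ c'
  same-offset b≤c b≤c' e = trans (sym (m∸n+n≡m b≤c)) (trans (cong (_+ b) e) (m∸n+n≡m b≤c'))

  -- f read as an endomap of Fin n via offsets; it is injective, hence onto
  offset : Fin n → Fin n
  offset x = fromℕ< (offset< (above x) (below x))

  offset-injective : ∀ x y → offset x ≡ offset y → x ≡ y
  offset-injective x y e = injective x y (same-offset (above x) (above y)
    (fromℕ<-injective _ _ (offset< (above x) (below x)) (offset< (above y) (below y)) e))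

  hits : ∀ c → b ≤ c → c < b + n → ∃ λ x → f x ≡ c
  hits c b≤c c<b+n with fin-injective⇒surjective offset offset-injective (fromℕ< (offset< b≤c c<b+n))
  ... | x , e = x , same-offset (above x) b≤c
    (fromℕ<-injective _ _ (offset< (above x) (below x)) (offset< b≤c c<b+n) e)

  interval : IsIntervalList values
  interval a a' c a∈ a'∈ a≤c c≤a' with from-member a∈ | from-member a'∈
  ... | x , refl | y , refl with hits c (≤-trans (above x) a≤c) (≤-<-trans c≤a' (below y))
  ... | z , fz≡c = subst (_∈ values) fz≡c (member z)

  minimum : Fin n → minL values ≡ b
  minimum x₀ with hits b ≤-refl (m<m+n b (≤-<-trans z≤n (toℕ<n x₀)))
  ... | x , fx≡b = ≤-antisym (subst (minL values ≤_) fx≡b (minL-≤ values (member x)))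
    (minL-greatest values (member x₀) λ p → let (y , fy≡c) = from-member p in subst (b ≤_) fy≡c (above y))

compare-shifted : ∀ X Y a b P u w → X + a < Y + b → b + u ≡ a + w → X + (P + u) < Y + (P + w)
compare-shifted X Y a b P u w lt e = +-cancelʳ-< a _ _ (begin-strict
    X + (P + u) + a    ≡⟨ regroup₁ X P u a ⟩
    (X + a) + (P + u)  <⟨ +-monoˡ-< (P + u) lt ⟩
    (Y + b) + (P + u)  ≡⟨ regroup₂ Y b P u ⟩
    Y + P + (b + u)    ≡⟨ cong (Y + P +_) e ⟩
    Y + P + (a + w)    ≡⟨ regroup₃ Y P a w ⟩
    Y + (P + w) + a    ∎)
  where
  open ≤-Reasoning
  regroup₁ : ∀ X P u a → X + (P + u) + a ≡ (X + a) + (P + u)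
  regroup₁ = solve-∀
  regroup₂ : ∀ Y b P u → (Y + b) + (P + u) ≡ Y + P + (b + u)
  regroup₂ = solve-∀
  regroup₃ : ∀ Y P a w → Y + P + (a + w) ≡ Y + (P + w) + a
  regroup₃ = solve-∀

module Steps (n : ℕ) (d : ℕ → ℕ) (nondecreasing : ∀ k → suc k < n → d k ≤ d (suc k)) where

  monotone : ∀ {i j} → i ≤ j → j < n → d i ≤ d j
  monotone {i} {zero} z≤n _ = ≤-refl
  monotone {i} {suc j} i≤sj sj<n with m≤n⇒m<n∨m≡n i≤sj
  ... | inj₂ refl = ≤-refl
  ... | inj₁ (s≤s i≤j) = ≤-trans (monotone i≤j (<-trans (n<1+n j) sj<n)) (nondecreasing j sj<n)

module Construction (n : ℕ) (d : ℕ → ℕ)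
    (nondecreasing : ∀ k → suc k < n → d k ≤ d (suc k))
    (unit-step : ∀ k → suc k < n → d (suc k) ≤ suc (d k)) where

  open Steps n d nondecreasing public

  growth-from : ∀ i t → i + t < n → d (i + t) ≤ d i + t
  growth-from i zero _ rewrite +-identityʳ i | +-identityʳ (d i) = ≤-refl
  growth-from i (suc t) p rewrite +-suc i t | +-suc (d i) t =
    ≤-trans (unit-step (i + t) p) (s≤s (growth-from i t (<-trans (n<1+n _) p)))

  growth : ∀ {i k} → i ≤ k → k < n → d k + i ≤ d i + k
  growth {i} {k} i≤k k<n = begin
      d k + i                ≡⟨ cong (λ z → d z + i) (sym (m+[n∸m]≡n i≤k)) ⟩
      d (i + (k ∸ i)) + i    ≤⟨ +-monoˡ-≤ i (growth-from i (k ∸ i) (subst (_< n) (sym (m+[n∸m]≡n i≤k)) k<n)) ⟩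
      d i + (k ∸ i) + i      ≡⟨ +-assoc (d i) (k ∸ i) i ⟩
      d i + (k ∸ i + i)      ≡⟨ cong (d i +_) (m∸n+n≡m i≤k) ⟩
      d i + k                ∎
    where open ≤-Reasoning

  below-window : ∀ {x y} → x < n → y < n → d x + y < d y + n
  below-window {x} {y} x<n y<n = begin-strict
      d x + y        ≤⟨ +-monoˡ-≤ y (monotone (m≤m⊔n x y) x⊔y<n) ⟩
      d (x ⊔ y) + y  ≤⟨ growth (m≤n⊔m x y) x⊔y<n ⟩
      d y + (x ⊔ y)  <⟨ +-monoʳ-< (d y) x⊔y<n ⟩
      d y + n        ∎
    where
    open ≤-Reasoning
    x⊔y<n : x ⊔ y < n
    x⊔y<n = ⊔-lub x<n y<n

  Repeat : ℕ → Set
  Repeat zero = ⊥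
  Repeat (suc j) = d (suc j) ≡ d j

  repeat? : ∀ j → Dec (Repeat j)
  repeat? zero = no (λ ())
  repeat? (suc j) = d (suc j) ≟ d j

  repeat-gap : ∀ {a j} → Repeat j → a < j → j < n → d j + a < d a + j
  repeat-gap {a} {suc k} r (s≤s a≤k) j<n rewrite r | +-suc (d a) k =
    s≤s (growth a≤k (<-trans (n<1+n k) j<n))

  fresh-jump : ∀ {a j} → ¬ Repeat j → a < j → j < n → d a < d j
  fresh-jump {a} {suc k} fresh (s≤s a≤k) j<n =
    ≤-<-trans (monotone a≤k (<-trans (n<1+n k) j<n)) (≤∧≢⇒< (nondecreasing k j<n) (λ e → fresh (sym e)))

  colour : ℕ → ℕ → ℕ
  colour i j with repeat? j
  ... | no _ = d j + i
  ... | yes _ with i <? j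
  ... | yes _ = d j + (i + (n ∸ j))
  ... | no _ = d j + (i ∸ j)

  data View (i j : ℕ) : ℕ → Set where
    fresh : ¬ Repeat j → View i j (d j + i)
    wrap  : Repeat j → i < j → View i j (d j + (i + (n ∸ j)))
    shift : Repeat j → j ≤ i → View i j (d j + (i ∸ j))

  view : ∀ i j → View i j (colour i j)
  view i j with repeat? j
  ... | no ¬r = fresh ¬r
  ... | yes r with i <? j
  ... | yes i<j = wrap r i<j
  ... | no i≮j = shift r (≮⇒≥ i≮j)

  column-above : ∀ {i j m} → View i j m → d j ≤ m
  column-above (fresh _) = m≤m+n _ _
  column-above (wrap _ _) = m≤m+n _ _
  column-above (shift _ _) = m≤m+n _ _

  column-below : ∀ {i j m} → i < n → j < n → View i j m → m < d j + n
  column-below i<n j<n (fresh _) = +-monoʳ-< _ i<n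
  column-below {i} {j} i<n j<n (wrap _ i<j) =
    +-monoʳ-< _ (subst (i + (n ∸ j) <_) (m+[n∸m]≡n (<⇒≤ j<n)) (+-monoˡ-< (n ∸ j) i<j))
  column-below {i} {j} i<n j<n (shift _ _) = +-monoʳ-< _ (≤-<-trans (m∸n≤m i j) i<n)

  -- ... and distinct rows get distinct colours, since i ↦ (i − j) mod n is injective.
  column-injective : ∀ {i i' j m m'} → i < n → i' < n → View i j m → View i' j m' → m ≡ m' → i ≡ i'
  column-injective _ _ (fresh _) (fresh _) e = +-cancelˡ-≡ _ _ _ e
  column-injective {j = j} _ _ (wrap _ _) (wrap _ _) e = +-cancelʳ-≡ (n ∸ j) _ _ (+-cancelˡ-≡ (d j) _ _ e)
  column-injective {j = j} _ _ (shift _ j≤i) (shift _ j≤i') e =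
    trans (sym (m∸n+n≡m j≤i)) (trans (cong (_+ j) (+-cancelˡ-≡ _ _ _ e)) (m∸n+n≡m j≤i'))
  column-injective _ i'<n (wrap _ _) (shift _ j≤i') e = ⊥-elim (wrap≢shift i'<n j≤i' (+-cancelˡ-≡ _ _ _ e))
    where
    wrap≢shift : ∀ {i i' j} → i' < n → j ≤ i' → i + (n ∸ j) ≢ i' ∸ j
    wrap≢shift {i} {i'} {j} i'<n j≤i' e = <-irrefl (sym e) (<-≤-trans (∸-monoˡ-< i'<n j≤i') (m≤n+m (n ∸ j) i))
  column-injective i<n i'<n (shift r j≤i) (wrap r' i'<j) e = sym (column-injective i'<n i<n (wrap r' i'<j) (shift r j≤i) (sym e))
  column-injective _ _ (fresh ¬r) (wrap r _) _ = ⊥-elim (¬r r)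
  column-injective _ _ (fresh ¬r) (shift r _) _ = ⊥-elim (¬r r)
  column-injective _ _ (wrap r _) (fresh ¬r) _ = ⊥-elim (¬r r)
  column-injective _ _ (shift r _) (fresh ¬r) _ = ⊥-elim (¬r r)

  row-above : ∀ {i j m} → i < n → j < n → View i j m → d i ≤ m
  row-above {i} {j} i<n j<n (fresh _) =
    ≤-trans (subst (_≤ d 0 + i) (+-identityʳ (d i)) (growth z≤n i<n)) (+-monoˡ-≤ i (monotone z≤n j<n))
  row-above i<n j<n (wrap _ i<j) = ≤-trans (monotone (<⇒≤ i<j) j<n) (m≤m+n _ _)
  row-above {i} {j} i<n j<n (shift _ j≤i) = +-cancelʳ-≤ j _ _ (subst (d i + j ≤_) regroup (growth j≤i i<n))
    where
    regroup : d j + i ≡ d j + (i ∸ j) + j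
    regroup = trans (cong (d j +_) (sym (m∸n+n≡m j≤i))) (sym (+-assoc (d j) (i ∸ j) j))

  row-below : ∀ {i j m} → i < n → j < n → View i j m → m < d i + n
  row-below i<n j<n (fresh _) = below-window j<n i<n
  row-below {i} {j} i<n j<n (wrap r i<j) = begin-strict
      d j + (i + (n ∸ j))  ≡⟨ sym (+-assoc (d j) i (n ∸ j)) ⟩
      d j + i + (n ∸ j)    <⟨ +-monoˡ-< (n ∸ j) (repeat-gap r i<j j<n) ⟩
      d i + j + (n ∸ j)    ≡⟨ +-assoc (d i) j (n ∸ j) ⟩
      d i + (j + (n ∸ j))  ≡⟨ cong (d i +_) (m+[n∸m]≡n (<⇒≤ j<n)) ⟩
      d i + n              ∎
    where open ≤-Reasoning
  row-below {i} {j} i<n j<n (shift _ j≤i) = +-mono-≤-< (monotone j≤i i<n) (≤-<-trans (m∸n≤m i j) i<n)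

  fresh<wrap : ∀ {x y} i → x < n → y < n → d x + i < d y + (i + (n ∸ y))
  fresh<wrap {x} {y} i x<n y<n = subst (_< d y + (i + (n ∸ y))) (cong (d x +_) (+-identityʳ i))
    (compare-shifted (d x) (d y) y n i 0 (n ∸ y) (below-window x<n y<n)
      (trans (+-identityʳ n) (sym (m+[n∸m]≡n (<⇒≤ y<n)))))

  shift<fresh : ∀ {x y i} → Repeat y → y < n → y ≤ i → x < n → d y + (i ∸ y) < d x + i
  shift<fresh {x} {suc k} {i} r y<n y≤i x<n = begin-strict
      d (suc k) + (i ∸ suc k)        ≡⟨ cong (d (suc k) +_) (sym (+-identityʳ (i ∸ suc k))) ⟩
      d (suc k) + ((i ∸ suc k) + 0)  <⟨ compare-shifted (d (suc k)) (d 0) 0 (suc k) (i ∸ suc k) 0 (suc k)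
                                           (repeat-gap r (s≤s z≤n) y<n) (+-identityʳ (suc k)) ⟩
      d 0 + ((i ∸ suc k) + suc k)    ≡⟨ cong (d 0 +_) (m∸n+n≡m y≤i) ⟩
      d 0 + i                        ≤⟨ +-monoˡ-≤ i (monotone z≤n x<n) ⟩
      d x + i                        ∎
    where open ≤-Reasoning

  -- Within a band the colours are strictly monotone in j, so distinct columns j < j' of a row
  -- get distinct colours.
  row-distinct : ∀ {i j j' m m'} → j < j' → j' < n → View i j m → View i j' m' → m ≢ m'
  row-distinct {i} j<j' j'<n (fresh _) (fresh ¬r') = <⇒≢ (+-monoˡ-< i (fresh-jump ¬r' j<j' j'<n))
  row-distinct {i} j<j' j'<n (fresh _) (wrap _ _) = <⇒≢ (fresh<wrap i (<-trans j<j' j'<n) j'<n)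
  row-distinct j<j' j'<n (fresh _) (shift r' j'≤i) = >⇒≢ (shift<fresh r' j'<n j'≤i (<-trans j<j' j'<n))
  row-distinct {i} j<j' j'<n (wrap _ _) (fresh _) = >⇒≢ (fresh<wrap i j'<n (<-trans j<j' j'<n))
  row-distinct j<j' j'<n (shift r j≤i) (fresh _) = <⇒≢ (shift<fresh r (<-trans j<j' j'<n) j≤i j'<n)
  row-distinct {i} {j} {j'} j<j' j'<n (wrap _ _) (wrap r' _) =
    >⇒≢ (compare-shifted _ _ j j' i (n ∸ j') (n ∸ j) (repeat-gap r' j<j' j'<n)
      (trans (m+[n∸m]≡n (<⇒≤ j'<n)) (sym (m+[n∸m]≡n (<⇒≤ (<-trans j<j' j'<n))))))
  row-distinct {i} {j} {j'} j<j' j'<n (shift _ j≤i) (shift r' j'≤i) =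
    >⇒≢ (compare-shifted _ _ j j' 0 (i ∸ j') (i ∸ j) (repeat-gap r' j<j' j'<n)
      (trans (m+[n∸m]≡n j'≤i) (sym (m+[n∸m]≡n j≤i))))
  row-distinct j<j' j'<n (wrap _ i<j) (shift _ j'≤i) = ⊥-elim (<-irrefl refl (<-trans (≤-<-trans j'≤i i<j) j<j'))
  row-distinct {i} {j} {j'} j<j' j'<n (shift _ j≤i) (wrap _ _) =
    <⇒≢ (+-mono-≤-< (monotone (<⇒≤ j<j') j'<n) (≤-<-trans (m∸n≤m i j) (m<m+n i (m<n⇒0<n∸m j'<n))))

  row-injective : ∀ {i j j'} → j < n → j' < n → colour i j ≡ colour i j' → j ≡ j'
  row-injective {i} {j} {j'} j<n j'<n e with <-cmp j j'
  ... | tri< j<j' _ _ = ⊥-elim (row-distinct j<j' j'<n (view i j) (view i j') e)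
  ... | tri≈ _ j≡j' _ = j≡j'
  ... | tri> _ _ j'<j = ⊥-elim (row-distinct j'<j j<n (view i j') (view i j) (sym e))

-- The k-th entry of a list of naturals (0 past its end).
at : List ℕ → ℕ → ℕ
at [] _ = 0
at (x ∷ xs) zero = x
at (x ∷ xs) (suc k) = at xs k

at-lookup : ∀ L (u : Fin (length L)) → at L (toℕ u) ≡ lookup L u
at-lookup (x ∷ L) Fin.zero = refl
at-lookup (x ∷ L) (Fin.suc u) = at-lookup L u

at-∈ : ∀ L k → k < length L → at L k ∈ L
at-∈ (x ∷ L) zero _ = here refl
at-∈ (x ∷ L) (suc k) (s≤s k<n) = there (at-∈ L k k<n)

position : ∀ {x} L → x ∈ L → ∃ λ (u : Fin (length L)) → at L (toℕ u) ≡ x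
position L p = index p , trans (at-lookup L (index p)) (sym (lookup-index p))

sorted-step : ∀ L → Sorted L → ∀ k → suc k < length L → at L k ≤ at L (suc k)
sorted-step (x ∷ []) [-] zero (s≤s ())
sorted-step (x ∷ y ∷ L) (x≤y ∷ _) zero _ = x≤y
sorted-step (x ∷ y ∷ L) (_ ∷ y∷L↗) (suc k) (s≤s sk<n) = sorted-step (y ∷ L) y∷L↗ k sk<n

-- A continuous list rises by at most one at each step: otherwise at L k + 1 would be an
-- entry (it lies between two entries) strictly between two consecutive entries.
continuous-unit-step : ∀ L → Sorted L → IsIntervalList L →
  ∀ k → suc k < length L → at L (suc k) ≤ suc (at L k)
continuous-unit-step L L↗ interval k sk<n with at L (suc k) ≤? suc (at L k)
... | yes step≤1 = step≤1
... | no step≰1 = ⊥-elim (no-entry-between (position L between))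
  where
  open Steps (length L) (at L) (sorted-step L L↗)
  k<n : k < length L
  k<n = <-trans (n<1+n k) sk<n
  jump : suc (at L k) < at L (suc k)
  jump = ≰⇒> step≰1
  between : suc (at L k) ∈ L
  between = interval _ _ _ (at-∈ L k k<n) (at-∈ L (suc k) sk<n) (n≤1+n _) (<⇒≤ jump)
  no-entry-between : (∃ λ (u : Fin (length L)) → at L (toℕ u) ≡ suc (at L k)) → ⊥
  no-entry-between (u , e) with toℕ u ≤? k
  ... | yes u≤k = <-irrefl e (s≤s (monotone u≤k k<n))
  ... | no u≰k = <-irrefl (sym e) (<-≤-trans jump (monotone (≰⇒> u≰k) (toℕ<n u)))

sort-sorted : ∀ L → Sorted L → sort L ≡ L
sort-sorted L L↗ = Pointwise-≡⇒≡ (↗↭↗⇒≋ ≤-totalOrder (sort-↗ L) L↗ (↭⇒↭ₛ (sort-↭ L)))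

module Assembly (L : List ℕ) (L↗ : Sorted L) (L-interval : IsIntervalList L) where

  n : ℕ
  n = length L

  d : ℕ → ℕ
  d = at L

  open Construction n d (sorted-step L L↗) (continuous-unit-step L L↗ L-interval)

  α : EdgeColouring n
  α u v = colour (toℕ u) (toℕ v)

  module Row (u : Fin n) = Window n (α u) (d (toℕ u))
    (λ v → row-above (toℕ<n u) (toℕ<n v) (view _ _))
    (λ v → row-below (toℕ<n u) (toℕ<n v) (view _ _))
    (λ v v' e → toℕ-injective (row-injective (toℕ<n v) (toℕ<n v') e))

  module Column (v : Fin n) = Window n (λ u → α u v) (d (toℕ v))
    (λ u → column-above (view _ _))
    (λ u → column-below (toℕ<n u) (toℕ<n v) (view _ _))
    (λ u u' e → toℕ-injective (column-injective (toℕ<n u) (toℕ<n u') (view _ (toℕ v)) (view _ _) e))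

  proper : Proper α
  proper = (λ u v v' v≢v' e → v≢v' (toℕ-injective (row-injective (toℕ<n v) (toℕ<n v') e)))
         , (λ v u u' u≢u' e → u≢u' (toℕ-injective
             (column-injective (toℕ<n u) (toℕ<n u') (view _ (toℕ v)) (view _ _) e)))

  used⇒in-window : ∀ {c} → c ∈ allColours α → ∃ λ u → d (toℕ u) ≤ c × c < d (toℕ u) + n
  used⇒in-window p with find (∈-concatMap⁻ (specU α) {xs = allFin n} p)
  ... | u , _ , q with Row.from-member u q
  ... | v , refl = u , row-above (toℕ<n u) (toℕ<n v) (view _ _) , row-below (toℕ<n u) (toℕ<n v) (view _ _)

  in-window⇒used : ∀ {c} u → d (toℕ u) ≤ c → c < d (toℕ u) + n → c ∈ allColours α
  in-window⇒used {c} u lo hi with Row.hits u c lo hi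
  ... | v , refl = ∈-concatMap⁺ (specU α) {xs = allFin n} (lose (∈-allFin u) (Row.member u v))

  -- A colour c above the window of u₁ but below the top of the window of u₂ is used: the
  -- number c' = c + 1 − n lies between d_{u₁} and d_{u₂}, so it is an entry d_u of L, and c
  -- lies in the window of u.
  beyond-window : ∀ {c} u₁ u₂ → d (toℕ u₁) + n ≤ c → c < d (toℕ u₂) + n → c ∈ allColours α
  beyond-window {c} u₁ u₂ top₁≤c c<top₂ =
    in-window⇒used u (subst (_≤ c) (sym du≡c') c'≤c) (subst (λ z → c < z + n) (sym du≡c') c<c'+n)
    where
    c' : ℕ
    c' = suc c ∸ n
    d₁≤c' : d (toℕ u₁) ≤ c'
    d₁≤c' = m+n≤o⇒m≤o∸n (d (toℕ u₁)) (≤-trans top₁≤c (n≤1+n c))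
    c'≤d₂ : c' ≤ d (toℕ u₂)
    c'≤d₂ = m≤n+o⇒m∸n≤o (suc c) n (subst (suc c ≤_) (+-comm (d (toℕ u₂)) n) c<top₂)
    entry : ∃ λ (u : Fin n) → d (toℕ u) ≡ c'
    entry = position L (L-interval _ _ c' (at-∈ L _ (toℕ<n u₁)) (at-∈ L _ (toℕ<n u₂)) d₁≤c' c'≤d₂)
    u : Fin n
    u = proj₁ entry
    du≡c' : d (toℕ u) ≡ c'
    du≡c' = proj₂ entry
    c'≤c : c' ≤ c
    c'≤c = ∸-monoʳ-≤ (suc c) (m<n⇒0<n (toℕ<n u₁))
    c<c'+n : c < c' + n
    c<c'+n = ≤-reflexive (sym (m∸n+n≡m (≤-trans (m≤n+m n _) (≤-trans top₁≤c (n≤1+n c)))))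

  colours-interval : IsIntervalList (allColours α)
  colours-interval a b c a∈ b∈ a≤c c≤b with used⇒in-window a∈ | used⇒in-window b∈
  ... | u₁ , lo₁ , _ | u₂ , _ , hi₂ with c <? d (toℕ u₁) + n
  ... | yes c<top₁ = in-window⇒used u₁ (≤-trans lo₁ a≤c) c<top₁
  ... | no c≮top₁ = beyond-window u₁ u₂ (≮⇒≥ c≮top₁) (≤-<-trans c≤b hi₂)

  lower-ends : (f : Fin n → ℕ) → (∀ u → f u ≡ d (toℕ u)) → map f (allFin n) ≡ L
  lower-ends f f≡d = trans (map-cong (λ u → trans (f≡d u) (at-lookup L u)) (allFin n))
                          (trans (map-tabulate (λ x → x) (lookup L)) (tabulate-lookup L))

lemma1 : (n : ℕ) (L : List ℕ) → length L ≡ n → Continuous L →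
    Σ (EdgeColouring n) (λ α → IsIntervalColouring α × (LSE-U α ≡ L) × (LSE-V α ≡ L))
lemma1 .(length L) L refl (L↗ , L-interval) =
  α , (proper , colours-interval , Row.interval , Column.interval)
    , trans (cong sort (lower-ends _ (λ u → Row.minimum u u))) (sort-sorted L L↗)
    , trans (cong sort (lower-ends _ (λ v → Column.minimum v v))) (sort-sorted L L↗)
  where open Assembly L L↗ L-interval
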